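{- Let $\mathcal{P}$ be a profile of unrooted phylogenetic trees whose display graph $G(\mathcal{P})$ is connected. Let $F$ be a legal minimal cut of $G(\mathcal{P})$ and let $G_1,G_2$ be the two connected components of $G(\mathcal{P})-F$. Then $\mathcal{L}(G_1)|\mathcal{L}(G_2)$ is a split of $\mathcal{L}(\mathcal{P})$, where $\mathcal{L}(G_i)$ is the set of leaf vertices of $G_i$.
   Context: A phylogenetic tree is an unrooted tree whose leaves are bijectively labeled; a profile $\mathcal{P}$ is a finite collection of phylogenetic trees, $\mathcal{L}(\mathcal{P})$ the union of their label sets. The display graph $G(\mathcal{P})$ is the union of the trees of $\mathcal{P}$, where leaves with the same label are identified and all other vertices of different trees are distinct; its leaf vertices are the labels, all other vertices are internal; an edge is internal if both endpoints are internal. A minimal cut of a connected graph is an inclusion-minimal edge set whose removal disconnects it (so removal leaves exactly two components). A cut $F$ of $G(\mathcal{P})$ is legal if (LC1) for every $T\in\mathcal{P}$ the edges of $T$ in $F$ are incident on a common vertex and (LC2) every connected component of $G(\mathcal{P})-F$ contains at least one edge. A split of a set $L$ is a bipartition $\{X,Y\}$ of $L$ into two nonempty parts, written $X|Y$. -}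

module Defs where

open import Data.Nat using (ℕ; zero; suc; _+_; _≤_)
open import Data.Fin using (Fin; _≟_)
open import Data.Bool using (Bool; true; false; not)
open import Data.List using (List; length; lookup; map)
open import Data.Nat.ListAction using (sum)
open import Data.Product using (Σ; ∃; _×_; _,_; proj₁; proj₂)
open import Data.Sum using (_⊎_; inj₁; inj₂)
open import Data.Sum.Properties using (≡-dec)
open import Data.Unit using (⊤)
open import Data.Empty using (⊥)
open import Relation.Nullary using (¬_; does)
open import Relation.Binary.PropositionalEquality using (_≡_)
open import Function.Definitions using (Injective)

-- Generic (multi)graph walks.
-- A graph is given by an edge index type E and an endpoint map
-- ends : E → V × V ; 'usable' selects which edges may be traversed
-- (used to delete a cut F).

IncidentTo : {V : Set} → V → V × V → Set
IncidentTo v (a , b) = (v ≡ a) ⊎ (v ≡ b)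

Joins : {V : Set} → V × V → V → V → Set
Joins (a , b) u w = ((u ≡ a) × (w ≡ b)) ⊎ ((u ≡ b) × (w ≡ a))

data Walk {V E : Set} (ends : E → V × V) (usable : E → Bool) : V → V → Set where
  here : ∀ {u} → Walk ends usable u u
  step : ∀ {u w v} (e : E) → usable e ≡ true → Joins (ends e) u w →
         Walk ends usable w v → Walk ends usable u v

-- Vertices: inj₁ i (internal, i < nInt) or inj₂ j (leaf vertex j < nLab,
-- carrying label 'lab j'; 'lab' injective, so leaves are bijectively labeled).

TV : ℕ → ℕ → Set
TV nI nL = Fin nI ⊎ Fin nL

degree : {n m : ℕ} → List (TV n m × TV n m) → TV n m → ℕ
degree es v = sum (map (λ ab → ind (proj₁ ab) + ind (proj₂ ab)) es)
  where
  ind : _ → ℕ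
  ind x with does (≡-dec _≟_ _≟_ x v)
  ... | true  = 1
  ... | false = 0

record PhyloTree : Set where
  field
    nInt  : ℕ
    nLab  : ℕ
    lab   : Fin nLab → ℕ
    edges : List (TV nInt nLab × TV nInt nLab)

  Vtx : Set
  Vtx = TV nInt nLab

  Edge : Set
  Edge = Fin (length edges)

  endsT : Edge → Vtx × Vtx
  endsT = lookup edges

  field
    lab-injective : Injective _≡_ _≡_ lab
    nonempty  : 1 ≤ nInt + nLab
    connected : ∀ (u v : Vtx) → Walk endsT (λ _ → true) u v
    edgeCount : suc (length edges) ≡ nInt + nLab
    -- the labeled vertices are exactly the leaves:
    -- labeled vertices have degree ≤ 1, internal vertices degree ≥ 2
    leafDeg   : ∀ (j : Fin nLab) → degree edges (inj₂ j) ≤ 1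
    intDeg    : ∀ (i : Fin nInt) → 2 ≤ degree edges (inj₁ i)

open PhyloTree public

Profile : ℕ → Set
Profile p = Fin p → PhyloTree

module _ {p : ℕ} (P : Profile p) where

  InL : ℕ → Set
  InL ℓ = Σ (Fin p) λ i → Σ (Fin (nLab (P i))) λ j → lab (P i) j ≡ ℓ

  -- vertex type of the display graph: labels (leaf vertices) or
  -- (tree index, internal vertex of that tree)
  DV : Set
  DV = ℕ ⊎ Σ (Fin p) (λ i → Fin (nInt (P i)))

  -- actual vertex set of G(P)
  InG : DV → Set
  InG (inj₁ ℓ) = InL ℓ
  InG (inj₂ _) = ⊤

  DE : Set
  DE = Σ (Fin p) (λ i → Edge (P i))

  embed : (i : Fin p) → Vtx (P i) → DV
  embed i (inj₁ x) = inj₂ (i , x)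
  embed i (inj₂ j) = inj₁ (lab (P i) j)

  ends : DE → DV × DV
  ends (i , k) = embed i (proj₁ (endsT (P i) k)) , embed i (proj₂ (endsT (P i) k))

  EdgeSet : Set
  EdgeSet = DE → Bool

  _⊆E_ : EdgeSet → EdgeSet → Set
  F ⊆E F′ = ∀ e → F e ≡ true → F′ e ≡ true

  Reach : EdgeSet → DV → DV → Set
  Reach F = Walk ends (λ e → not (F e))

  Connected : Set
  Connected = ∀ u v → InG u → InG v → Reach (λ _ → false) u v

  Disconnects : EdgeSet → Set
  Disconnects F = Σ DV λ u → Σ DV λ v → InG u × InG v × ¬ Reach F u v

  MinimalCut : EdgeSet → Set
  MinimalCut F = Disconnects F × (∀ F′ → F′ ⊆E F → Disconnects F′ → F ⊆E F′)

  LC1 : EdgeSet → Set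
  LC1 F = ∀ (i : Fin p) → Σ DV λ v → ∀ (k : Edge (P i)) → F (i , k) ≡ true →
            IncidentTo v (ends (i , k))

  LC2 : EdgeSet → Set
  LC2 F = ∀ u → InG u → Σ DE λ e → (F e ≡ false) × Reach F (proj₁ (ends e)) u

  Legal : EdgeSet → Set
  Legal F = LC1 F × LC2 F

  LeavesOf : EdgeSet → DV → ℕ → Set
  LeavesOf F u ℓ = InL ℓ × Reach F (inj₁ ℓ) u

IsSplit : (L X Y : ℕ → Set) → Set
IsSplit L X Y =
    (∀ ℓ → X ℓ → L ℓ) × (∀ ℓ → Y ℓ → L ℓ)
  × (∀ ℓ → L ℓ → X ℓ ⊎ Y ℓ)
  × (∀ ℓ → X ℓ → Y ℓ → ⊥)
  × (∃ λ ℓ → X ℓ) × (∃ λ ℓ → Y ℓ)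

-- Minimality forces every cut edge to have an endpoint in every component of G(P) − F, since
-- otherwise the cut edges touching one component would already disconnect it.  A cut edge has
-- two endpoints, so the components of u₁ and u₂ are the only ones, and every label lies in
-- exactly one of them.  Each component contains a label by a counting argument in one tree T:
-- by (LC2) the component contains an uncut edge of T, and by (LC1) the cut edges of T form a
-- star at a vertex y.  If every vertex of the component K of T − F had degree at least 2, the
-- handshake identity  Σ_{x ∈ K} deg x = 2·#inner K + #boundary K  would contradict the forest
-- bound #inner S < |S| in T (for S = K, and S = K ∪ {y} when y ∉ K).  So K contains a vertex
-- of degree at most 1, that is, a leaf.
module Submission where

open import Defs

open import Data.Bool using (Bool; true; false; not; _∧_; _∨_; _xor_)
import Data.Bool.Properties as Bool
open import Data.Empty using (⊥; ⊥-elim)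
open import Data.Fin using (Fin; splitAt; join)
import Data.Fin as Fin
open import Data.Fin.Properties using (splitAt-join; join-splitAt)
open import Data.List using (List; []; _∷_; length; filter; map; lookup; tabulate; allFin; concatMap)
open import Data.List.Membership.Propositional using (_∈_; find; lose)
open import Data.List.Membership.Propositional.Properties using (∈-filter⁺; ∈-map⁺; ∈-allFin; ∈-concatMap⁺)
open import Data.List.Properties
  using (length-removeAt′; length-map; length-tabulate; tabulate-lookup; map-tabulate)
import Data.List.Relation.Unary.All as All
open import Data.List.Relation.Unary.AllPairs using (_∷_)
open import Data.List.Relation.Unary.Any using (here; there; any?; _─_)
open import Data.List.Relation.Unary.Unique.Propositional using (Unique)
import Data.List.Relation.Unary.Unique.Propositional.Properties as Unique
import Data.Nat as ℕ
open import Data.Nat using (ℕ; suc; _+_; _*_; _≤_; _<_; z≤n; s≤s; _<?_)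
open import Data.Nat.Properties
open import Algebra.Properties.CommutativeSemigroup +-commutativeSemigroup using (interchange)
open import Data.Nat.Tactic.RingSolver using (solve-∀)
open import Data.Product using (Σ; ∃; ∃-syntax; _×_; _,_; proj₁; proj₂)
import Data.Product.Properties as Product
open import Data.Sum using (_⊎_; inj₁; inj₂)
import Data.Sum as Sum
open import Data.Sum.Properties using (≡-dec; inj₁-injective)
open import Function using (id; _∘_)
open import Function.Bundles using (mk⇔)
open import Function.Definitions using (Injective)
open import Relation.Binary.Definitions using (DecidableEquality)
open import Relation.Binary.PropositionalEquality
open import Relation.Nullary using (¬_; Dec; yes; no; does)
open import Relation.Nullary.Decidable using (_⊎-dec_; _×-dec_; map′; dec-true; does-⇔)

private variable A B : Set

𝟙 : Bool → ℕ
𝟙 true  = 1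
𝟙 false = 0

𝟙-∧-xor : ∀ a b → 𝟙 a + 𝟙 b ≡ 2 * 𝟙 (a ∧ b) + 𝟙 (a xor b)
𝟙-∧-xor true  true  = refl
𝟙-∧-xor true  false = refl
𝟙-∧-xor false true  = refl
𝟙-∧-xor false false = refl

𝟙-not : ∀ b → 𝟙 (not b) + 𝟙 b ≡ 1
𝟙-not true  = refl
𝟙-not false = refl

xor-true⇒≢ : ∀ {a b} → a xor b ≡ true → a ≢ b
xor-true⇒≢ {a} a⊕a refl with () ← trans (sym (Bool.xor-same a)) a⊕a

witness : (a? : Dec A) → does a? ≡ true → A
witness (yes a) _ = a

inner+crossing≤inner-∪ : ∀ a b c d → (a xor b ≡ true → c ≡ true × a ≡ false ⊎ d ≡ true × b ≡ false) →
                         𝟙 (a ∧ b) + 𝟙 (a xor b) ≤ 𝟙 ((a ∨ c) ∧ (b ∨ d))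
inner+crossing≤inner-∪ true  true  c d _ = ≤-refl
inner+crossing≤inner-∪ false false c d _ = z≤n
inner+crossing≤inner-∪ true  false c d leaves with leaves refl
... | inj₁ (_ , ())
... | inj₂ (refl , _) = ≤-refl
inner+crossing≤inner-∪ false true  c d leaves with leaves refl
... | inj₁ (refl , _) = ≤-refl
... | inj₂ (_ , ())

∑ : (A → ℕ) → List A → ℕ
∑ f []       = 0
∑ f (x ∷ xs) = f x + ∑ f xs

∑-cong : {f g : A → ℕ} (xs : List A) → (∀ x → f x ≡ g x) → ∑ f xs ≡ ∑ g xs
∑-cong []       f≗g = refl
∑-cong (x ∷ xs) f≗g = cong₂ _+_ (f≗g x) (∑-cong xs f≗g)

∑-mono-≤ : {f g : A → ℕ} (xs : List A) → (∀ x → f x ≤ g x) → ∑ f xs ≤ ∑ g xs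
∑-mono-≤ []       f≤g = z≤n
∑-mono-≤ (x ∷ xs) f≤g = +-mono-≤ (f≤g x) (∑-mono-≤ xs f≤g)

∑-distrib-+ : (f g : A → ℕ) (xs : List A) → ∑ (λ x → f x + g x) xs ≡ ∑ f xs + ∑ g xs
∑-distrib-+ f g []       = refl
∑-distrib-+ f g (x ∷ xs) =
  trans (cong (f x + g x +_) (∑-distrib-+ f g xs)) (interchange (f x) (g x) _ _)

∑-distribˡ-* : (c : ℕ) (f : A → ℕ) (xs : List A) → ∑ (λ x → c * f x) xs ≡ c * ∑ f xs
∑-distribˡ-* c f []       = sym (*-zeroʳ c)
∑-distribˡ-* c f (x ∷ xs) =
  trans (cong (c * f x +_) (∑-distribˡ-* c f xs)) (sym (*-distribˡ-+ c (f x) _))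

∑-const : (c : ℕ) (xs : List A) → ∑ (λ _ → c) xs ≡ c * length xs
∑-const c []       = sym (*-zeroʳ c)
∑-const c (x ∷ xs) = trans (cong (c +_) (∑-const c xs)) (sym (*-suc c _))

∑-comm : (h : A → B → ℕ) (xs : List A) (ys : List B) →
         ∑ (λ x → ∑ (h x) ys) xs ≡ ∑ (λ y → ∑ (λ x → h x y) xs) ys
∑-comm h []       ys = sym (∑-const 0 ys)
∑-comm h (x ∷ xs) ys =
  trans (cong (∑ (h x) ys +_) (∑-comm h xs ys)) (sym (∑-distrib-+ (h x) _ ys))

∑-map : (g : B → ℕ) (f : A → B) (xs : List A) → ∑ g (map f xs) ≡ ∑ (λ x → g (f x)) xs
∑-map g f []       = refl
∑-map g f (x ∷ xs) = cong (g (f x) +_) (∑-map g f xs)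

∑-lookup : (g : A → ℕ) (xs : List A) → ∑ g xs ≡ ∑ (λ k → g (lookup xs k)) (allFin (length xs))
∑-lookup g xs = begin
  ∑ g xs                                   ≡⟨ cong (∑ g) (tabulate-lookup xs) ⟨
  ∑ g (tabulate (lookup xs))               ≡⟨ cong (∑ g) (map-tabulate id (lookup xs)) ⟨
  ∑ g (map (lookup xs) (allFin (length xs))) ≡⟨ ∑-map g (lookup xs) (allFin (length xs)) ⟩
  ∑ (λ k → g (lookup xs k)) (allFin (length xs)) ∎
  where open ≡-Reasoning

length-filter-true : (S : A → Bool) (xs : List A) →
                     length (filter (λ x → S x Bool.≟ true) xs) ≡ ∑ (λ x → 𝟙 (S x)) xs
length-filter-true S []       = refl
length-filter-true S (x ∷ xs) with S x
... | true  = cong suc (length-filter-true S xs)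
... | false = length-filter-true S xs

module _ (_≟_ : DecidableEquality A) (a : A) (f : A → ℕ) where

  ∑-unselected : {xs : List A} → All.All (λ x → a ≢ x) xs →
                 ∑ (λ x → 𝟙 (does (a ≟ x)) * f x) xs ≡ 0
  ∑-unselected {[]}     All.[] = refl
  ∑-unselected {x ∷ xs} (a≢x All.∷ a∉xs) with a ≟ x
  ... | yes a≡x = ⊥-elim (a≢x a≡x)
  ... | no _    = ∑-unselected a∉xs

  ∑-select : {xs : List A} → Unique xs → a ∈ xs →
             ∑ (λ x → 𝟙 (does (a ≟ x)) * f x) xs ≡ f a
  ∑-select {x ∷ xs} (a∉xs ∷ _) (here refl) with a ≟ a
  ... | no a≢a = ⊥-elim (a≢a refl)
  ... | yes _  = begin
    f a + 0 + ∑ (λ x → 𝟙 (does (a ≟ x)) * f x) xs ≡⟨ cong (f a + 0 +_) (∑-unselected a∉xs) ⟩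
    f a + 0 + 0                                   ≡⟨ +-identityʳ _ ⟩
    f a + 0                                       ≡⟨ +-identityʳ _ ⟩
    f a                                           ∎
    where open ≡-Reasoning
  ∑-select {x ∷ xs} (a∉xs ∷ xs!) (there a∈xs) with a ≟ x
  ... | yes refl = ⊥-elim (All.lookup a∉xs a∈xs refl)
  ... | no _     = ∑-select xs! a∈xs

∈-─⁺ : ∀ {x y : A} {xs} (x∈xs : x ∈ xs) → y ∈ xs → x ≢ y → y ∈ (xs ─ x∈xs)
∈-─⁺ (here refl) (here refl)  x≢y = ⊥-elim (x≢y refl)
∈-─⁺ (here refl) (there y∈xs) x≢y = y∈xs
∈-─⁺ (there x∈xs) (here refl) x≢y = here refl
∈-─⁺ (there x∈xs) (there y∈xs) x≢y = there (∈-─⁺ x∈xs y∈xs x≢y)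

Unique-length-≤ : {xs ys : List A} → Unique xs → (∀ {x} → x ∈ xs → x ∈ ys) → length xs ≤ length ys
Unique-length-≤ {xs = []}     _           _    = z≤n
Unique-length-≤ {xs = x ∷ xs} {ys} (x∉xs ∷ xs!) xs⊆ys = begin
  suc (length xs)                       ≤⟨ s≤s (Unique-length-≤ xs! xs⊆ys─x) ⟩
  suc (length (ys ─ xs⊆ys (here refl))) ≡⟨ length-removeAt′ ys _ ⟨
  length ys                             ∎
  where
  open ≤-Reasoning
  xs⊆ys─x : ∀ {y} → y ∈ xs → y ∈ (ys ─ xs⊆ys (here refl))
  xs⊆ys─x y∈xs = ∈-─⁺ (xs⊆ys (here refl)) (xs⊆ys (there y∈xs)) (All.lookup x∉xs y∈xs)

Joins-sym : ∀ {V : Set} {x : V × V} {u w} → Joins x u w → Joins x w u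
Joins-sym (inj₁ (u≡a , w≡b)) = inj₂ (w≡b , u≡a)
Joins-sym (inj₂ (u≡b , w≡a)) = inj₁ (w≡a , u≡b)

module _ {V E : Set} {ends : E → V × V} {usable : E → Bool} where

  infixr 5 _++ʷ_

  _++ʷ_ : ∀ {u v w} → Walk ends usable u v → Walk ends usable v w → Walk ends usable u w
  here            ++ʷ q = q
  step e ok j p   ++ʷ q = step e ok j (p ++ʷ q)

  reverseʷ : ∀ {u v} → Walk ends usable u v → Walk ends usable v u
  reverseʷ here           = here
  reverseʷ (step e ok j p) = reverseʷ p ++ʷ step e ok (Joins-sym j) here

  meet : ∀ {z u v} → Walk ends usable z u → Walk ends usable z v → Walk ends usable u v
  meet p q = reverseʷ p ++ʷ q

module EdgeListWalks {V E : Set} (_≟_ : DecidableEquality V)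
                     (ends : E → V × V) (usable : E → Bool) where

  src tgt : E → V
  src e = proj₁ (ends e)
  tgt e = proj₂ (ends e)

  data WalkIn (es : List E) : V → V → Set where
    done : ∀ {u} → WalkIn es u u
    via  : ∀ {u w v} (e : E) → e ∈ es → usable e ≡ true → Joins (ends e) u w →
           WalkIn es w v → WalkIn es u v

  infixr 5 _++ⁱ_

  _++ⁱ_ : ∀ {es u v w} → WalkIn es u v → WalkIn es v w → WalkIn es u w
  done            ++ⁱ q = q
  via e e∈ ok j p ++ⁱ q = via e e∈ ok j (p ++ⁱ q)

  WalkIn-[] : ∀ {u v} → WalkIn [] u v → u ≡ v
  WalkIn-[] done = refl

  WalkIn-weaken : ∀ {e es u v} → WalkIn es u v → WalkIn (e ∷ es) u v
  WalkIn-weaken done            = done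
  WalkIn-weaken (via e e∈ ok j p) = via e (there e∈) ok j (WalkIn-weaken p)

  Crossing : E → List E → V → V → Set
  Crossing e es u v = usable e ≡ true ×
    (WalkIn es u (src e) × WalkIn es (tgt e) v ⊎ WalkIn es u (tgt e) × WalkIn es (src e) v)

  -- A walk that uses e twice can be shortcut to one that uses it at most once.
  WalkIn-∷⁻ : ∀ {e es u v} → WalkIn (e ∷ es) u v → WalkIn es u v ⊎ Crossing e es u v
  WalkIn-∷⁻ done = inj₁ done
  WalkIn-∷⁻ (via e′ (there e′∈) ok j p) with WalkIn-∷⁻ p
  ... | inj₁ q                   = inj₁ (via e′ e′∈ ok j q)
  ... | inj₂ (ok′ , inj₁ (q , r)) = inj₂ (ok′ , inj₁ (via e′ e′∈ ok j q , r))
  ... | inj₂ (ok′ , inj₂ (q , r)) = inj₂ (ok′ , inj₂ (via e′ e′∈ ok j q , r))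
  WalkIn-∷⁻ (via e (here refl) ok (inj₁ (refl , refl)) p) with WalkIn-∷⁻ p
  ... | inj₁ q                  = inj₂ (ok , inj₁ (done , q))
  ... | inj₂ (_ , inj₁ (_ , r)) = inj₂ (ok , inj₁ (done , r))
  ... | inj₂ (_ , inj₂ (_ , r)) = inj₁ r
  WalkIn-∷⁻ (via e (here refl) ok (inj₂ (refl , refl)) p) with WalkIn-∷⁻ p
  ... | inj₁ q                  = inj₂ (ok , inj₂ (done , q))
  ... | inj₂ (_ , inj₁ (_ , r)) = inj₁ r
  ... | inj₂ (_ , inj₂ (_ , r)) = inj₂ (ok , inj₂ (done , r))

  WalkIn-∷⁺ : ∀ {e es u v} → WalkIn es u v ⊎ Crossing e es u v → WalkIn (e ∷ es) u v
  WalkIn-∷⁺ (inj₁ p) = WalkIn-weaken p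
  WalkIn-∷⁺ {e} (inj₂ (ok , inj₁ (p , q))) =
    WalkIn-weaken p ++ⁱ via e (here refl) ok (inj₁ (refl , refl)) (WalkIn-weaken q)
  WalkIn-∷⁺ {e} (inj₂ (ok , inj₂ (p , q))) =
    WalkIn-weaken p ++ⁱ via e (here refl) ok (inj₂ (refl , refl)) (WalkIn-weaken q)

  walkIn? : ∀ es u v → Dec (WalkIn es u v)
  walkIn? []       u v = map′ (λ { refl → done }) WalkIn-[] (u ≟ v)
  walkIn? (e ∷ es) u v = map′ WalkIn-∷⁺ WalkIn-∷⁻
    (walkIn? es u v ⊎-dec ((usable e Bool.≟ true) ×-dec
      ((walkIn? es u (src e) ×-dec walkIn? es (tgt e) v) ⊎-dec
       (walkIn? es u (tgt e) ×-dec walkIn? es (src e) v))))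

  WalkIn⇒Walk : ∀ {es u v} → WalkIn es u v → Walk ends usable u v
  WalkIn⇒Walk done             = here
  WalkIn⇒Walk (via e _ ok j p) = step e ok j (WalkIn⇒Walk p)

  Walk⇒WalkIn : ∀ {es} → (∀ e → e ∈ es) → ∀ {u v} → Walk ends usable u v → WalkIn es u v
  Walk⇒WalkIn ∈es here           = done
  Walk⇒WalkIn ∈es (step e ok j p) = via e (∈es e) ok j (Walk⇒WalkIn ∈es p)

  walk? : ∀ {es} → (∀ e → e ∈ es) → ∀ u v → Dec (Walk ends usable u v)
  walk? {es} ∈es u v = map′ WalkIn⇒Walk (Walk⇒WalkIn ∈es) (walkIn? es u v)

  #usable : List E → ℕ
  #usable = ∑ (λ e → 𝟙 (usable e))

  Rooted : List E → List V → V → Set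
  Rooted es roots x = ∃[ r ] r ∈ roots × WalkIn es x r

  -- Induction on es: whatever reaches a root through e reaches an endpoint of e without e, so
  -- one endpoint of e added to the roots makes up for the loss of e.
  length≤#usable+#roots : (es : List E) (roots vs : List V) → Unique vs →
                          (∀ {x} → x ∈ vs → Rooted es roots x) → length vs ≤ #usable es + length roots
  length≤#usable+#roots [] roots vs vs! rooted =
    Unique-length-≤ vs! λ x∈vs → let r , r∈ , p = rooted x∈vs in subst (_∈ roots) (sym (WalkIn-[] p)) r∈
  length≤#usable+#roots (e ∷ es) roots vs vs! rooted with usable e in ok
  ... | false = length≤#usable+#roots es roots vs vs! λ x∈vs → unused (rooted x∈vs)
    where
    unused : ∀ {x} → Rooted (e ∷ es) roots x → Rooted es roots x
    unused (r , r∈ , p) with WalkIn-∷⁻ p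
    ... | inj₁ q        = r , r∈ , q
    ... | inj₂ (ok′ , _) with () ← trans (sym ok) ok′
  ... | true with any? (λ r → walkIn? es (tgt e) r) roots
  ...   | yes tgt-rooted = subst (length vs ≤_) (+-suc _ _)
           (length≤#usable+#roots es (src e ∷ roots) vs vs! λ x∈vs → reroot (rooted x∈vs))
    where
    reroot : ∀ {x} → Rooted (e ∷ es) roots x → Rooted es (src e ∷ roots) x
    reroot (r , r∈ , p) with WalkIn-∷⁻ p
    ... | inj₁ q                  = r , there r∈ , q
    ... | inj₂ (_ , inj₁ (q , _)) = src e , here refl , q
    ... | inj₂ (_ , inj₂ (q , _)) = let r′ , r′∈ , q′ = find tgt-rooted in r′ , there r′∈ , q ++ⁱ q′
  ...   | no tgt-unrooted = subst (length vs ≤_) (+-suc _ _)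
           (length≤#usable+#roots es (tgt e ∷ roots) vs vs! λ x∈vs → reroot (rooted x∈vs))
    where
    reroot : ∀ {x} → Rooted (e ∷ es) roots x → Rooted es (tgt e ∷ roots) x
    reroot (r , r∈ , p) with WalkIn-∷⁻ p
    ... | inj₁ q                  = r , there r∈ , q
    ... | inj₂ (_ , inj₁ (_ , q)) = ⊥-elim (tgt-unrooted (lose r∈ q))
    ... | inj₂ (_ , inj₂ (q , _)) = tgt e , here refl , q

module Tree (T : PhyloTree) where

  V : Set
  V = Vtx T

  _≟ᵛ_ : DecidableEquality V
  _≟ᵛ_ = ≡-dec Fin._≟_ Fin._≟_

  src tgt : Edge T → V
  src k = proj₁ (endsT T k)
  tgt k = proj₂ (endsT T k)

  allEdges : List (Edge T)
  allEdges = allFin (length (edges T))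

  vertices : List V
  vertices = map (splitAt (nInt T)) (allFin (nInt T + nLab T))

  vertices-unique : Unique vertices
  vertices-unique = Unique.map⁺ splitAt-injective (Unique.allFin⁺ _)
    where
    splitAt-injective : ∀ {i j} → splitAt (nInt T) i ≡ splitAt (nInt T) j → i ≡ j
    splitAt-injective {i} {j} eq = begin
      i                                      ≡⟨ join-splitAt (nInt T) (nLab T) i ⟨
      join (nInt T) (nLab T) (splitAt _ i)   ≡⟨ cong (join (nInt T) (nLab T)) eq ⟩
      join (nInt T) (nLab T) (splitAt _ j)   ≡⟨ join-splitAt (nInt T) (nLab T) j ⟩
      j                                      ∎
      where open ≡-Reasoning

  ∈-vertices : ∀ x → x ∈ vertices
  ∈-vertices x = subst (_∈ vertices) (splitAt-join (nInt T) (nLab T) x)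
                   (∈-map⁺ (splitAt (nInt T)) (∈-allFin (join (nInt T) (nLab T) x)))

  length-vertices : length vertices ≡ suc (length (edges T))
  length-vertices = begin
    length vertices                 ≡⟨ length-map (splitAt (nInt T)) (allFin (nInt T + nLab T)) ⟩
    length (allFin (nInt T + nLab T)) ≡⟨ length-tabulate id ⟩
    nInt T + nLab T                 ≡⟨ edgeCount T ⟨
    suc (length (edges T))          ∎
    where open ≡-Reasoning

  deg : V → ℕ
  deg = degree (edges T)

  incidence : V → Edge T → ℕ
  incidence x k = 𝟙 (does (src k ≟ᵛ x)) + 𝟙 (does (tgt k ≟ᵛ x))

  deg≡∑incidence : ∀ x → deg x ≡ ∑ (incidence x) allEdges
  deg≡∑incidence x = trans (degree≡∑ (edges T)) (∑-lookup _ (edges T))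
    where
    degree≡∑ : ∀ es → degree es x ≡ ∑ (λ (a , b) → 𝟙 (does (a ≟ᵛ x)) + 𝟙 (does (b ≟ᵛ x))) es
    degree≡∑ []            = refl
    degree≡∑ ((a , b) ∷ es) with does (a ≟ᵛ x) | does (b ≟ᵛ x)
    ... | true  | true  = cong (2 +_) (degree≡∑ es)
    ... | true  | false = cong suc (degree≡∑ es)
    ... | false | true  = cong suc (degree≡∑ es)
    ... | false | false = degree≡∑ es

  module _ (S : V → Bool) where

    size : ℕ
    size = ∑ (λ x → 𝟙 (S x)) vertices

    #inner : ℕ
    #inner = ∑ (λ k → 𝟙 (S (src k) ∧ S (tgt k))) allEdges

    #boundary : ℕ
    #boundary = ∑ (λ k → 𝟙 (S (src k) xor S (tgt k))) allEdges

    degreeSum : ℕ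
    degreeSum = ∑ (λ x → 𝟙 (S x) * deg x) vertices

    degreeSum≡2*#inner+#boundary : degreeSum ≡ 2 * #inner + #boundary
    degreeSum≡2*#inner+#boundary = begin
      ∑ (λ x → 𝟙 (S x) * deg x) vertices
        ≡⟨ ∑-cong vertices expand ⟩
      ∑ (λ x → ∑ (λ k → 𝟙 (S x) * incidence x k) allEdges) vertices
        ≡⟨ ∑-comm _ vertices allEdges ⟩
      ∑ (λ k → ∑ (λ x → 𝟙 (S x) * incidence x k) vertices) allEdges
        ≡⟨ ∑-cong allEdges endpoints ⟩
      ∑ (λ k → 𝟙 (S (src k)) + 𝟙 (S (tgt k))) allEdges
        ≡⟨ ∑-cong allEdges (λ k → 𝟙-∧-xor (S (src k)) (S (tgt k))) ⟩
      ∑ (λ k → 2 * 𝟙 (S (src k) ∧ S (tgt k)) + 𝟙 (S (src k) xor S (tgt k))) allEdges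
        ≡⟨ ∑-distrib-+ _ _ allEdges ⟩
      ∑ (λ k → 2 * 𝟙 (S (src k) ∧ S (tgt k))) allEdges + #boundary
        ≡⟨ cong (_+ #boundary) (∑-distribˡ-* 2 _ allEdges) ⟩
      2 * #inner + #boundary
        ∎
      where
      open ≡-Reasoning
      expand : ∀ x → 𝟙 (S x) * deg x ≡ ∑ (λ k → 𝟙 (S x) * incidence x k) allEdges
      expand x = trans (cong (𝟙 (S x) *_) (deg≡∑incidence x)) (sym (∑-distribˡ-* (𝟙 (S x)) (incidence x) allEdges))
      endpoints : ∀ k → ∑ (λ x → 𝟙 (S x) * incidence x k) vertices ≡ 𝟙 (S (src k)) + 𝟙 (S (tgt k))
      endpoints k = begin
        ∑ (λ x → 𝟙 (S x) * incidence x k) vertices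
          ≡⟨ ∑-cong vertices (λ x → trans (*-comm (𝟙 (S x)) _) (*-distribʳ-+ (𝟙 (S x)) (𝟙 (does (src k ≟ᵛ x))) _)) ⟩
        ∑ (λ x → 𝟙 (does (src k ≟ᵛ x)) * 𝟙 (S x) + 𝟙 (does (tgt k ≟ᵛ x)) * 𝟙 (S x)) vertices
          ≡⟨ ∑-distrib-+ _ _ vertices ⟩
        _ ≡⟨ cong₂ _+_ (∑-select _≟ᵛ_ (src k) (𝟙 ∘ S) vertices-unique (∈-vertices _))
                       (∑-select _≟ᵛ_ (tgt k) (𝟙 ∘ S) vertices-unique (∈-vertices _)) ⟩
        𝟙 (S (src k)) + 𝟙 (S (tgt k))
          ∎

    degreeSum-lower : ∀ z → S z ≡ true → (∀ x → S x ≡ true → z ≢ x → 2 ≤ deg x) →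
                      2 * size + deg z ≤ degreeSum + 2
    degreeSum-lower z Sz high = begin
      2 * size + deg z
        ≡⟨ cong₂ _+_ (∑-distribˡ-* 2 (𝟙 ∘ S) vertices) select-deg ⟨
      ∑ (λ x → 2 * 𝟙 (S x)) vertices + ∑ (λ x → 𝟙 (does (z ≟ᵛ x)) * deg z) vertices
        ≡⟨ ∑-distrib-+ _ _ vertices ⟨
      ∑ (λ x → 2 * 𝟙 (S x) + 𝟙 (does (z ≟ᵛ x)) * deg z) vertices
        ≤⟨ ∑-mono-≤ vertices pointwise ⟩
      ∑ (λ x → 𝟙 (S x) * deg x + 𝟙 (does (z ≟ᵛ x)) * 2) vertices
        ≡⟨ ∑-distrib-+ _ _ vertices ⟩
      degreeSum + ∑ (λ x → 𝟙 (does (z ≟ᵛ x)) * 2) vertices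
        ≡⟨ cong (degreeSum +_) (∑-select _≟ᵛ_ z (λ _ → 2) vertices-unique (∈-vertices z)) ⟩
      degreeSum + 2
        ∎
      where
      open ≤-Reasoning
      select-deg : ∑ (λ x → 𝟙 (does (z ≟ᵛ x)) * deg z) vertices ≡ deg z
      select-deg = ∑-select _≟ᵛ_ z (λ _ → deg z) vertices-unique (∈-vertices z)
      pointwise : ∀ x → 2 * 𝟙 (S x) + 𝟙 (does (z ≟ᵛ x)) * deg z ≤ 𝟙 (S x) * deg x + 𝟙 (does (z ≟ᵛ x)) * 2
      pointwise x with z ≟ᵛ x
      ... | yes refl rewrite Sz = ≤-reflexive (+-comm 2 (deg z + 0))
      ... | no z≢x with S x in Sx
      ...   | true  = +-monoˡ-≤ 0 (subst (2 ≤_) (sym (+-identityʳ (deg x))) (high x Sx z≢x))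
      ...   | false = z≤n

    outer : Edge T → Bool
    outer k = not (S (src k) ∧ S (tgt k))

    #outer : ℕ
    #outer = ∑ (λ k → 𝟙 (outer k)) allEdges

    #outer+#inner≡#edges : #outer + #inner ≡ length (edges T)
    #outer+#inner≡#edges = begin
      #outer + #inner                                       ≡⟨ ∑-distrib-+ _ _ allEdges ⟨
      ∑ (λ k → 𝟙 (outer k) + 𝟙 (S (src k) ∧ S (tgt k))) allEdges
                                                            ≡⟨ ∑-cong allEdges (λ k → 𝟙-not (S (src k) ∧ S (tgt k))) ⟩
      ∑ (λ _ → 1) allEdges                                  ≡⟨ ∑-const 1 allEdges ⟩
      1 * length allEdges                                   ≡⟨ *-identityˡ _ ⟩
      length allEdges                                       ≡⟨ length-tabulate id ⟩
      length (edges T)                                      ∎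
      where open ≡-Reasoning

    -- Every vertex of T reaches S through edges not inside S, so |V| ≤ #outer + |S|;
    -- together with |V| = #edges + 1 this says that S spans a forest.
    #inner<size : ∀ z → S z ≡ true → #inner < size
    #inner<size z Sz = +-cancelˡ-≤ #outer (suc #inner) size (begin
      #outer + suc #inner          ≡⟨ +-suc #outer #inner ⟩
      suc (#outer + #inner)        ≡⟨ cong suc #outer+#inner≡#edges ⟩
      suc (length (edges T))       ≡⟨ length-vertices ⟨
      length vertices              ≤⟨ length≤#usable+#roots allEdges roots vertices vertices-unique
                                        (λ {x} _ → rooted (connected T x z)) ⟩
      #outer + length roots        ≡⟨ cong (#outer +_) (length-filter-true S vertices) ⟩
      #outer + size                ∎)
      where
      open ≤-Reasoning
      open EdgeListWalks _≟ᵛ_ (endsT T) outer using (Rooted; done; via; length≤#usable+#roots)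
      roots : List V
      roots = filter (λ x → S x Bool.≟ true) vertices
      outer-from : ∀ {x w} k → Joins (endsT T k) x w → S x ≡ false → outer k ≡ true
      outer-from k (inj₁ (refl , _)) Sx rewrite Sx = refl
      outer-from k (inj₂ (refl , _)) Sx rewrite Sx | Bool.∧-zeroʳ (S (src k)) = refl
      rooted : ∀ {x} → Walk (endsT T) (λ _ → true) x z → Rooted allEdges roots x
      rooted here = z , ∈-filter⁺ _ (∈-vertices z) Sz , done
      rooted {x} (step k _ j p) with S x in Sx
      ... | true  = x , ∈-filter⁺ _ (∈-vertices x) Sx , done
      ... | false = let r , r∈ , q = rooted p in r , r∈ , via k (∈-allFin k) (outer-from k j Sx) j q

  insert : V → (V → Bool) → V → Bool
  insert y S x = S x ∨ does (y ≟ᵛ x)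

  size-insert : ∀ {S} y → S y ≡ false → size (insert y S) ≡ size S + 1
  size-insert {S} y Sy = begin
    ∑ (λ x → 𝟙 (insert y S x)) vertices                       ≡⟨ ∑-cong vertices split ⟩
    ∑ (λ x → 𝟙 (S x) + 𝟙 (does (y ≟ᵛ x)) * 1) vertices         ≡⟨ ∑-distrib-+ _ _ vertices ⟩
    size S + ∑ (λ x → 𝟙 (does (y ≟ᵛ x)) * 1) vertices         ≡⟨ cong (size S +_) y-once ⟩
    size S + 1                                                ∎
    where
    open ≡-Reasoning
    y-once : ∑ (λ x → 𝟙 (does (y ≟ᵛ x)) * 1) vertices ≡ 1
    y-once = ∑-select _≟ᵛ_ y (λ _ → 1) vertices-unique (∈-vertices y)
    split : ∀ x → 𝟙 (insert y S x) ≡ 𝟙 (S x) + 𝟙 (does (y ≟ᵛ x)) * 1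
    split x with y ≟ᵛ x
    ... | yes refl rewrite Sy = refl
    ... | no _ rewrite Bool.∨-identityʳ (S x) = sym (+-identityʳ _)

  1≤incidence : ∀ {y} k → IncidentTo y (endsT T k) → 1 ≤ incidence y k
  1≤incidence {y} k (inj₁ y≡src) rewrite dec-true (src k ≟ᵛ y) (sym y≡src) = s≤s z≤n
  1≤incidence {y} k (inj₂ y≡tgt) rewrite dec-true (tgt k ≟ᵛ y) (sym y≡tgt) = m≤n+m 1 _

module Component (T : PhyloTree) (cut : Edge T → Bool)
                 (y : Vtx T) (star : ∀ k → cut k ≡ true → IncidentTo y (endsT T k))
                 (e₀ : Edge T) (e₀-uncut : cut e₀ ≡ false) where

  open Tree T

  uncut : Edge T → Bool
  uncut k = not (cut k)

  reach? : ∀ x w → Dec (Walk (endsT T) uncut x w)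
  reach? = EdgeListWalks.walk? _≟ᵛ_ (endsT T) uncut ∈-allFin

  a₀ : V
  a₀ = src e₀

  K : V → Bool
  K x = does (reach? x a₀)

  K-a₀ : K a₀ ≡ true
  K-a₀ = dec-true (reach? a₀ a₀) here

  K-closed : ∀ k → cut k ≡ false → K (src k) ≡ K (tgt k)
  K-closed k uncut-k = does-⇔ (mk⇔ (step k ok (inj₂ (refl , refl))) (step k ok (inj₁ (refl , refl))))
                              (reach? (src k) a₀) (reach? (tgt k) a₀)
    where
    ok : uncut k ≡ true
    ok = cong not uncut-k

  crossing⇒cut : ∀ k → K (src k) xor K (tgt k) ≡ true → cut k ≡ true
  crossing⇒cut k crossing with cut k in cut-k
  ... | true  = refl
  ... | false = ⊥-elim (xor-true⇒≢ crossing (K-closed k cut-k))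

  HighDegree : Set
  HighDegree = ∀ x → K x ≡ true → 2 ≤ deg x

  inner+boundary≤inner-insert : K y ≡ false → #inner K + #boundary K ≤ #inner (insert y K)
  inner+boundary≤inner-insert Ky = begin
    #inner K + #boundary K                                                  ≡⟨ ∑-distrib-+ _ _ allEdges ⟨
    ∑ (λ k → 𝟙 (K (src k) ∧ K (tgt k)) + 𝟙 (K (src k) xor K (tgt k))) allEdges ≤⟨ ∑-mono-≤ allEdges edgewise ⟩
    #inner (insert y K)                                                     ∎
    where
    open ≤-Reasoning
    outer-end-y : ∀ k → cut k ≡ true →
                  does (y ≟ᵛ src k) ≡ true × K (src k) ≡ false ⊎ does (y ≟ᵛ tgt k) ≡ true × K (tgt k) ≡ false
    outer-end-y k cut-k with star k cut-k
    ... | inj₁ y≡src = inj₁ (dec-true (y ≟ᵛ src k) y≡src , trans (cong K (sym y≡src)) Ky)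
    ... | inj₂ y≡tgt = inj₂ (dec-true (y ≟ᵛ tgt k) y≡tgt , trans (cong K (sym y≡tgt)) Ky)
    edgewise : ∀ k → 𝟙 (K (src k) ∧ K (tgt k)) + 𝟙 (K (src k) xor K (tgt k)) ≤ 𝟙 (insert y K (src k) ∧ insert y K (tgt k))
    edgewise k = inner+crossing≤inner-∪ _ _ _ _ (outer-end-y k ∘ crossing⇒cut k)

  -- Adding the centre y to K turns every edge leaving K into an inner edge, and K ∪ {y} still
  -- spans a forest; so the degree sum of K stays below 2 |K|.
  center-outside : K y ≡ false → ¬ HighDegree
  center-outside Ky high = begin-contradiction
    2 * size K + 2                          ≤⟨ +-monoʳ-≤ (2 * size K) (high a₀ K-a₀) ⟩
    2 * size K + deg a₀                     ≤⟨ degreeSum-lower K a₀ K-a₀ (λ x Kx _ → high x Kx) ⟩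
    degreeSum K + 2                         ≡⟨ cong (_+ 2) (degreeSum≡2*#inner+#boundary K) ⟩
    2 * #inner K + #boundary K + 2          ≡⟨ regroup (#inner K) (#boundary K) ⟩
    #inner K + (#inner K + #boundary K) + 2 ≤⟨ +-monoˡ-≤ 2 (+-monoʳ-≤ (#inner K) (inner+boundary≤inner-insert Ky)) ⟩
    #inner K + #inner S + 2                 ≡⟨ +-suc-suc (#inner K) (#inner S) ⟩
    suc (#inner K) + suc (#inner S)         ≤⟨ +-mono-≤ (#inner<size K a₀ K-a₀) (#inner<size S a₀ S-a₀) ⟩
    size K + size S                         ≡⟨ cong (size K +_) (size-insert y Ky) ⟩
    size K + (size K + 1)                   ≡⟨ double (size K) ⟩
    2 * size K + 1                          <⟨ n<1+n _ ⟩
    suc (2 * size K + 1)                    ≡⟨ +-suc (2 * size K) 1 ⟨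
    2 * size K + 2                          ∎
    where
    open ≤-Reasoning
    S : V → Bool
    S = insert y K
    S-a₀ : S a₀ ≡ true
    S-a₀ = cong (_∨ does (y ≟ᵛ a₀)) K-a₀
    regroup : ∀ i b → 2 * i + b + 2 ≡ i + (i + b) + 2
    regroup = solve-∀
    +-suc-suc : ∀ i j → i + j + 2 ≡ suc i + suc j
    +-suc-suc = solve-∀
    double : ∀ n → n + (n + 1) ≡ 2 * n + 1
    double = solve-∀

  uncut-edge-at : ∀ {x} → Walk (endsT T) uncut x a₀ → ∃[ k ] cut k ≡ false × IncidentTo x (endsT T k)
  uncut-edge-at here                            = e₀ , e₀-uncut , inj₁ refl
  uncut-edge-at (step k ok (inj₁ (refl , _)) _) = k , Bool.not-injective {y = false} ok , inj₁ refl
  uncut-edge-at (step k ok (inj₂ (refl , _)) _) = k , Bool.not-injective {y = false} ok , inj₂ refl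

  boundary<deg : ∀ e₁ → cut e₁ ≡ false → IncidentTo y (endsT T e₁) → #boundary K + 1 ≤ deg y
  boundary<deg e₁ e₁-uncut e₁-at-y = begin
    #boundary K + 1
      ≡⟨ cong (#boundary K +_) (∑-select Fin._≟_ e₁ (λ _ → 1) (Unique.allFin⁺ _) (∈-allFin e₁)) ⟨
    #boundary K + ∑ (λ k → 𝟙 (does (e₁ Fin.≟ k)) * 1) allEdges
      ≡⟨ ∑-distrib-+ _ _ allEdges ⟨
    ∑ (λ k → 𝟙 (K (src k) xor K (tgt k)) + 𝟙 (does (e₁ Fin.≟ k)) * 1) allEdges
      ≤⟨ ∑-mono-≤ allEdges edgewise ⟩
    ∑ (incidence y) allEdges
      ≡⟨ deg≡∑incidence y ⟨
    deg y
      ∎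
    where
    open ≤-Reasoning
    edgewise : ∀ k → 𝟙 (K (src k) xor K (tgt k)) + 𝟙 (does (e₁ Fin.≟ k)) * 1 ≤ incidence y k
    edgewise k with e₁ Fin.≟ k
    ... | yes refl rewrite K-closed e₁ e₁-uncut | Bool.xor-same (K (tgt e₁)) = 1≤incidence e₁ e₁-at-y
    ... | no _ with K (src k) xor K (tgt k) in crossing
    ...   | true  = 1≤incidence k (star k (crossing⇒cut k crossing))
    ...   | false = z≤n

  -- Every edge leaving K is a cut edge at y, and some uncut edge at y lies inside K, so y has more
  -- incident edges than K has boundary edges; the degree count then contradicts #inner K < |K|.
  center-inside : K y ≡ true → ¬ HighDegree
  center-inside Ky high with e₁ , e₁-uncut , e₁-at-y ← uncut-edge-at (witness (reach? y a₀) Ky) = begin-contradiction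
    2 * size K + deg y                     ≤⟨ degreeSum-lower K y Ky (λ x Kx _ → high x Kx) ⟩
    degreeSum K + 2                        ≡⟨ cong (_+ 2) (degreeSum≡2*#inner+#boundary K) ⟩
    2 * #inner K + #boundary K + 2         <⟨ n<1+n _ ⟩
    suc (2 * #inner K + #boundary K + 2)   ≡⟨ regroup (#inner K) (#boundary K) ⟩
    2 * suc (#inner K) + (#boundary K + 1) ≤⟨ +-monoʳ-≤ (2 * suc (#inner K)) (boundary<deg e₁ e₁-uncut e₁-at-y) ⟩
    2 * suc (#inner K) + deg y             ≤⟨ +-monoˡ-≤ (deg y) (*-monoʳ-≤ 2 (#inner<size K a₀ K-a₀)) ⟩
    2 * size K + deg y                     ∎
    where
    open ≤-Reasoning
    regroup : ∀ i b → suc (2 * i + b + 2) ≡ 2 * suc i + (b + 1)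
    regroup = solve-∀

  ¬HighDegree : ¬ HighDegree
  ¬HighDegree with K y in Ky
  ... | true  = center-inside Ky
  ... | false = center-outside Ky

  leaf-in-component : ∃[ j ] Walk (endsT T) uncut (inj₂ j) a₀
  leaf-in-component with any? (λ x → (K x Bool.≟ true) ×-dec (deg x <? 2)) vertices
  ... | yes low with find low
  ...   | inj₁ i , _ , _ , deg<2 = ⊥-elim (<⇒≱ deg<2 (intDeg T i))
  ...   | inj₂ j , _ , Kj , _    = j , witness (reach? (inj₂ j) a₀) Kj
  leaf-in-component | no none = ⊥-elim (¬HighDegree λ x Kx →
    ≮⇒≥ (λ deg<2 → none (lose (∈-vertices x) (Kx , deg<2))))

module DisplayGraph {p : ℕ} (P : Profile p) where

  _≟ᵈ_ : DecidableEquality (DV P)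
  _≟ᵈ_ = ≡-dec ℕ._≟_ (Product.≡-dec Fin._≟_ Fin._≟_)

  allDE : List (DE P)
  allDE = concatMap (λ i → map (i ,_) (allFin (length (edges (P i))))) (allFin p)

  ∈-allDE : ∀ e → e ∈ allDE
  ∈-allDE (i , k) = ∈-concatMap⁺ (λ i → map (i ,_) (allFin (length (edges (P i)))))
                      (lose (∈-allFin i) (∈-map⁺ (i ,_) (∈-allFin k)))

  embed-injective : ∀ i → Injective _≡_ _≡_ (embed P i)
  embed-injective i {inj₁ x} {inj₁ .x} refl = refl
  embed-injective i {inj₂ x} {inj₂ y} eq    = cong inj₂ (lab-injective (P i) (inj₁-injective eq))

  incident-embedded : ∀ {i k v} → IncidentTo v (ends P (i , k)) → ∃[ a ] v ≡ embed P i a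
  incident-embedded (inj₁ v≡a) = _ , v≡a
  incident-embedded (inj₂ v≡b) = _ , v≡b

  -- LC1 only names a vertex of G(P); when tree i has a cut edge that vertex is an embedded
  -- vertex of tree i, and otherwise any vertex of tree i serves as the centre.
  star-center : ∀ {F} → LC1 P F → ∀ i → Vtx (P i) →
                Σ (Vtx (P i)) λ y → ∀ k → F (i , k) ≡ true → IncidentTo y (endsT (P i) k)
  star-center {F} lc1 i default with lc1 i | any? (λ k → F (i , k) Bool.≟ true) (allFin (length (edges (P i))))
  ... | _ , _ | no none = default , λ k Fk → ⊥-elim (none (lose (∈-allFin k) Fk))
  ... | v , star | yes some with k₁ , _ , Fk₁ ← find some
                           with a , v≡a ← incident-embedded (star k₁ Fk₁)
    = a , λ k Fk → Sum.map pull pull (star k Fk)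
    where
    pull : ∀ {b} → v ≡ embed P i b → a ≡ b
    pull v≡b = embed-injective i (trans (sym v≡a) v≡b)

  module _ (F : EdgeSet P) where

    reach? : ∀ u v → Dec (Reach P F u v)
    reach? = EdgeListWalks.walk? _≟ᵈ_ (ends P) (λ e → not (F e)) ∈-allDE

    embed-walk : ∀ i {x y} → Walk (endsT (P i)) (λ k → not (F (i , k))) x y →
                 Reach P F (embed P i x) (embed P i y)
    embed-walk i here = here
    embed-walk i (step k ok (inj₁ (refl , refl)) p) = step (i , k) ok (inj₁ (refl , refl)) (embed-walk i p)
    embed-walk i (step k ok (inj₂ (refl , refl)) p) = step (i , k) ok (inj₂ (refl , refl)) (embed-walk i p)

    component-has-leaf : Legal P F → ∀ u → InG P u → ∃ (LeavesOf P F u)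
    component-has-leaf (lc1 , lc2) u u∈G with lc2 u u∈G
    ... | (i , k) , Fk , k~u with star-center lc1 i (proj₁ (endsT (P i) k))
    ...   | y , star with Component.leaf-in-component (P i) (λ k′ → F (i , k′)) y star k Fk
    ...     | j , j~k = lab (P i) j , (i , j , refl) , embed-walk i j~k ++ʷ k~u

    reach-or-cut-edge : ∀ {u v} → Reach P (λ _ → false) u v → Reach P F u v ⊎ ∃[ f ] F f ≡ true
    reach-or-cut-edge here = inj₁ here
    reach-or-cut-edge (step e _ j p) with F e in Fe
    ... | true  = inj₂ (e , Fe)
    ... | false = Sum.map₁ (step e (cong not Fe) j) (reach-or-cut-edge p)

    cut-edge-touches : MinimalCut P F → ∀ {c d} → InG P c → InG P d → ¬ Reach P F c d →
                       ∀ f → F f ≡ true → Reach P F (proj₁ (ends P f)) c ⊎ Reach P F (proj₂ (ends P f)) c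
    cut-edge-touches (_ , minimal) {c} {d} c∈G d∈G c≁d f Ff =
      witness (touches f) (Bool.∧-conicalʳ _ _ (minimal F′ F′⊆F (c , d , c∈G , d∈G , c≁′d) f Ff))
      where
      touches : ∀ f → Dec (Reach P F (proj₁ (ends P f)) c ⊎ Reach P F (proj₂ (ends P f)) c)
      touches f = reach? (proj₁ (ends P f)) c ⊎-dec reach? (proj₂ (ends P f)) c
      F′ : EdgeSet P
      F′ f = F f ∧ does (touches f)
      F′⊆F : _⊆E_ P F′ F
      F′⊆F f = Bool.∧-conicalˡ _ _
      endpoint : ∀ {s t} e → Joins (ends P e) s t → Reach P F s c →
                 Reach P F (proj₁ (ends P e)) c ⊎ Reach P F (proj₂ (ends P e)) c
      endpoint e (inj₁ (refl , _)) s~c = inj₁ s~c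
      endpoint e (inj₂ (refl , _)) s~c = inj₂ s~c
      leave : ∀ {s t} e → not (F′ e) ≡ true → Joins (ends P e) s t → Reach P F s c → Reach P F t c
      leave e ok j s~c with F e in Fe
      ... | false = step e (cong not Fe) (Joins-sym j) s~c
      ... | true with () ← trans (sym ok) (cong not (dec-true (touches e) (endpoint e j s~c)))
      stays : ∀ {s t} → Reach P F′ s t → Reach P F s c → Reach P F t c
      stays here           s~c = s~c
      stays (step e ok j p) s~c = stays p (leave e ok j s~c)
      c≁′d : ¬ Reach P F′ c d
      c≁′d c~′d = c≁d (reverseʷ (stays c~′d here))

    no-third-component : Connected P → MinimalCut P F → ∀ {u₁ u₂ x} → InG P u₁ → InG P u₂ → InG P x →
                         ¬ Reach P F u₁ u₂ → ¬ Reach P F x u₁ → ¬ Reach P F x u₂ → ⊥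
    no-third-component conn mc {u₁} {u₂} u₁∈G u₂∈G x∈G u₁≁u₂ x≁u₁ x≁u₂
      with reach-or-cut-edge (conn u₁ u₂ u₁∈G u₂∈G)
    ... | inj₁ u₁~u₂ = u₁≁u₂ u₁~u₂
    ... | inj₂ (f , Ff)
      with cut-edge-touches mc u₁∈G u₂∈G u₁≁u₂ f Ff
         | cut-edge-touches mc u₂∈G u₁∈G (u₁≁u₂ ∘ reverseʷ) f Ff
         | cut-edge-touches mc x∈G u₁∈G x≁u₁ f Ff
    ... | inj₁ a~u₁ | inj₁ a~u₂ | _        = u₁≁u₂ (meet a~u₁ a~u₂)
    ... | inj₂ b~u₁ | inj₂ b~u₂ | _        = u₁≁u₂ (meet b~u₁ b~u₂)
    ... | inj₁ a~u₁ | inj₂ _    | inj₁ a~x = x≁u₁ (meet a~x a~u₁)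
    ... | inj₁ _    | inj₂ b~u₂ | inj₂ b~x = x≁u₂ (meet b~x b~u₂)
    ... | inj₂ b~u₁ | inj₁ _    | inj₂ b~x = x≁u₁ (meet b~x b~u₁)
    ... | inj₂ _    | inj₁ a~u₂ | inj₁ a~x = x≁u₂ (meet a~x a~u₂)

open DisplayGraph

lemma6 : (p : ℕ) (P : Profile p) → Connected P →
         (F : EdgeSet P) → Legal P F → MinimalCut P F →
         (u₁ u₂ : DV P) → InG P u₁ → InG P u₂ → ¬ Reach P F u₁ u₂ →
         IsSplit (InL P) (LeavesOf P F u₁) (LeavesOf P F u₂)
lemma6 p P conn F legal mc u₁ u₂ u₁∈G u₂∈G u₁≁u₂ =
    (λ _ → proj₁) , (λ _ → proj₁) , covers , disjoint
  , component-has-leaf P F legal u₁ u₁∈G , component-has-leaf P F legal u₂ u₂∈G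
  where
  covers : ∀ ℓ → InL P ℓ → LeavesOf P F u₁ ℓ ⊎ LeavesOf P F u₂ ℓ
  covers ℓ ℓ∈L with reach? P F (inj₁ ℓ) u₁ | reach? P F (inj₁ ℓ) u₂
  ... | yes ℓ~u₁ | _        = inj₁ (ℓ∈L , ℓ~u₁)
  ... | no _     | yes ℓ~u₂ = inj₂ (ℓ∈L , ℓ~u₂)
  ... | no ℓ≁u₁  | no ℓ≁u₂  = ⊥-elim (no-third-component P F conn mc u₁∈G u₂∈G ℓ∈L u₁≁u₂ ℓ≁u₁ ℓ≁u₂)
  disjoint : ∀ ℓ → LeavesOf P F u₁ ℓ → LeavesOf P F u₂ ℓ → ⊥
  disjoint ℓ (_ , ℓ~u₁) (_ , ℓ~u₂) = u₁≁u₂ (meet ℓ~u₁ ℓ~u₂)
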